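{- Let $\alpha<\varepsilon_0$ be a nonzero ordinal in Cantor normal form and $k\in\mathbb{N}$, and use fundamental sequences with $\omega_x=x+1$. If $\alpha$ is $k$-lean, then $P_k(\alpha)$ is also $k$-lean, and moreover $P_k(\alpha)=\max\{\alpha' : \alpha'\text{ is }k\text{ -lean and }\alpha'\prec_k\alpha\}$.
   Context: An ordinal in CNF is $k$-lean if in strict form $\omega^{\beta_1}\cdot c_1+\cdots+\omega^{\beta_m}\cdot c_m$ ($\beta_1>\cdots>\beta_m$, coefficients $c_i>0$) all $c_i\leq k$ and all $\beta_i$ are $k$-lean. Fundamental sequences for limits: $(\gamma+\omega^{\beta+1})_x=\gamma+\omega^\beta\cdot(x+1)$, $(\gamma+\omega^\lambda)_x=\gamma+\omega^{\lambda_x}$. Predecessor for nonzero ordinals: $P_x(\beta+1)=\beta$, $P_x(\lambda)=P_x(\lambda_x)$. $\prec_x$ is the smallest transitive relation with $\beta\prec_x\beta+1$ and $\lambda_x\prec_x\lambda$ for every limit $\lambda$. -}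

module Defs where

open import Data.Nat using (ℕ; zero; suc; _≤_) renaming (_<_ to _<ℕ_)
open import Data.Maybe using (Maybe; just; nothing)
open import Data.Product using (_×_)
open import Data.Sum using (_⊎_)
open import Data.Unit using (⊤)
open import Relation.Binary.PropositionalEquality using (_≡_)
open import Relation.Nullary using (¬_)

-- Ordinals below ε₀ as (hereditary) Cantor normal form terms.
-- ω^ a · c + b  denotes  ω^a · (c+1) + b  (so coefficients are always > 0).
data Ord : Set where
  𝟎 : Ord
  ω^_·_+_ : Ord → ℕ → Ord → Ord

coef : ℕ → ℕ
coef c = suc c

-- Ordinal order on CNF terms (lexicographic; correct on normal forms).
data _<ₒ_ : Ord → Ord → Set where
  <-zero : ∀ {a c b} → 𝟎 <ₒ (ω^ a · c + b)
  <-exp  : ∀ {a c b a' c' b'} → a <ₒ a' → (ω^ a · c + b) <ₒ (ω^ a' · c' + b')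
  <-coef : ∀ {a c b c' b'} → c <ℕ c' → (ω^ a · c + b) <ₒ (ω^ a · c' + b')
  <-rest : ∀ {a c b b'} → b <ₒ b' → (ω^ a · c + b) <ₒ (ω^ a · c + b')

_≤ₒ_ : Ord → Ord → Set
α ≤ₒ β = (α <ₒ β) ⊎ (α ≡ β)

ExpBelow : Ord → Ord → Set
ExpBelow 𝟎 a = ⊤
ExpBelow (ω^ a' · _ + _) a = a' <ₒ a

data NF : Ord → Set where
  nf-𝟎 : NF 𝟎
  nf-ω : ∀ {a c b} → NF a → NF b → ExpBelow b a → NF (ω^ a · c + b)

data Lean (k : ℕ) : Ord → Set where
  lean-𝟎 : Lean k 𝟎
  lean-ω : ∀ {a c b} → coef c ≤ k → Lean k a → Lean k b → Lean k (ω^ a · c + b)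

succ : Ord → Ord
succ 𝟎 = ω^ 𝟎 · zero + 𝟎
succ (ω^ 𝟎 · c + b) = ω^ 𝟎 · suc c + b
succ (ω^ (ω^ a · c' + b') · c + b) = ω^ (ω^ a · c' + b') · c + succ b

-- predecessor if the (normal form) ordinal is a successor, nothing otherwise
pr : Ord → Maybe Ord
pr 𝟎 = nothing
pr (ω^ 𝟎 · zero + b) = just 𝟎
pr (ω^ 𝟎 · suc c + b) = just (ω^ 𝟎 · c + b)
pr (ω^ (ω^ a · c' + b') · c + b) with pr b
... | just p = just (ω^ (ω^ a · c' + b') · c + p)
... | nothing = nothing

data Limit : Ord → Set where
  lim-last : ∀ {a c} → ¬ (a ≡ 𝟎) → Limit (ω^ a · c + 𝟎)
  lim-cons : ∀ {a c b} → Limit b → Limit (ω^ a · c + b)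

-- Fundamental sequences λ[x] (meaningful for limits λ):
--   (γ + ω^(β+1))[x] = γ + ω^β·(x+1),   (γ + ω^λ)[x] = γ + ω^(λ[x]).
-- In particular ω[x] = x + 1.
mutual
  fs : Ord → ℕ → Ord
  fs 𝟎 x = 𝟎
  fs (ω^ a · c + (ω^ a' · c' + b')) x = ω^ a · c + fs (ω^ a' · c' + b') x
  fs (ω^ a · zero + 𝟎) x = fsω a (pr a) x
  fs (ω^ a · suc c + 𝟎) x = ω^ a · c + fsω a (pr a) x

  -- (ω^a)[x] for a ≠ 0, given pr a
  fsω : Ord → Maybe Ord → ℕ → Ord
  fsω a (just a₀) x = ω^ a₀ · x + 𝟎
  fsω a nothing x = ω^ (fs a x) · zero + 𝟎

-- Graph of the predecessor function P_x on nonzero ordinals: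
--   P_x(β+1) = β,  P_x(λ) = P_x(λ[x]).
data P (x : ℕ) : Ord → Ord → Set where
  P-succ : ∀ {β} → NF β → P x (succ β) β
  P-lim  : ∀ {λ' β} → NF λ' → Limit λ' → P x (fs λ' x) β → P x λ' β

data _≺[_]_ : Ord → ℕ → Ord → Set where
  ≺-succ  : ∀ {x β} → NF β → β ≺[ x ] succ β
  ≺-lim   : ∀ {x λ'} → NF λ' → Limit λ' → fs λ' x ≺[ x ] λ'
  ≺-trans : ∀ {x α β γ} → α ≺[ x ] β → β ≺[ x ] γ → α ≺[ x ] γ

module Submission where

-- P_k(α) is reached from α by a chain α ↦ α[k] ↦ … of limit steps ended by
-- one successor step β + 1 ↦ β.  Two facts drive the proof.
--  * Every ordinal of the chain is "almost k-lean" (all terms k-lean except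
--    the last, which may have coefficient k + 1 or be ω^a with a almost
--    k-lean); for such a limit λ, λ[k] is again almost k-lean but never
--    k-lean, while for β + 1 almost k-lean, β is k-lean.
--  * ≺_x is generated by deterministic one-step relations: each α has at most
--    one immediate ≺_x-predecessor (β for β + 1, λ[x] for λ), so everything
--    ≺_x-below α is ≼_x-below that immediate predecessor.
-- The theorem follows by well-founded induction along the chain, using that
-- <ₒ is well-founded on normal forms.

open import Defs
open import Data.Nat using (ℕ; zero; suc; _≤_) renaming (_<_ to _<ℕ_)
open import Data.Nat.Properties using (≤-pred; m≤n⇒m≤1+n; 1+n≰n; n<1+n; ≤-refl; <-trans)
open import Data.Nat.Induction using (<-wellFounded)
open import Data.Maybe using (just; nothing)
open import Data.Maybe.Properties using (just-injective)
open import Data.Product using (Σ; _×_; _,_)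
open import Data.Sum using (_⊎_; inj₁; inj₂)
open import Data.Unit using (tt)
open import Data.Empty using (⊥-elim)
open import Function using (case_of_)
open import Induction.WellFounded using (Acc; acc)
open import Relation.Binary.PropositionalEquality using (_≡_; refl; sym; trans; cong; subst; _≢_)
open import Relation.Nullary using (¬_)

<ₒ-trans : ∀ {α β γ} → α <ₒ β → β <ₒ γ → α <ₒ γ
<ₒ-trans <-zero (<-exp _) = <-zero
<ₒ-trans <-zero (<-coef _) = <-zero
<ₒ-trans <-zero (<-rest _) = <-zero
<ₒ-trans (<-exp p) (<-exp q) = <-exp (<ₒ-trans p q)
<ₒ-trans (<-exp p) (<-coef _) = <-exp p
<ₒ-trans (<-exp p) (<-rest _) = <-exp p
<ₒ-trans (<-coef _) (<-exp q) = <-exp q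
<ₒ-trans (<-coef p) (<-coef q) = <-coef (<-trans p q)
<ₒ-trans (<-coef p) (<-rest _) = <-coef p
<ₒ-trans (<-rest _) (<-exp q) = <-exp q
<ₒ-trans (<-rest _) (<-coef q) = <-coef q
<ₒ-trans (<-rest p) (<-rest q) = <-rest (<ₒ-trans p q)

expBelow⇒<ₒ : ∀ δ {a c b} → ExpBelow δ a → δ <ₒ (ω^ a · c + b)
expBelow⇒<ₒ 𝟎 _ = <-zero
expBelow⇒<ₒ (ω^ _ · _ + _) h = <-exp h

expBelow-trans : ∀ δ {a e} → ExpBelow δ a → a <ₒ e → ExpBelow δ e
expBelow-trans 𝟎 _ _ = tt
expBelow-trans (ω^ _ · _ + _) h a<e = <ₒ-trans h a<e

-- Adding 1 changes the leading exponent only when it is 𝟎, i.e. for finite β.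
expBelow-succ : ∀ β {a c b} → ExpBelow β (ω^ a · c + b) → ExpBelow (succ β) (ω^ a · c + b)
expBelow-succ 𝟎 _ = <-zero
expBelow-succ (ω^ 𝟎 · _ + _) h = h
expBelow-succ (ω^ (ω^ _ · _ + _) · _ + _) h = h

expBelow-succ⁻ : ∀ β {e} → ExpBelow (succ β) e → ExpBelow β e
expBelow-succ⁻ 𝟎 _ = tt
expBelow-succ⁻ (ω^ 𝟎 · _ + _) h = h
expBelow-succ⁻ (ω^ (ω^ _ · _ + _) · _ + _) h = h

β<ₒsuccβ : ∀ β → β <ₒ succ β
β<ₒsuccβ 𝟎 = <-zero
β<ₒsuccβ (ω^ 𝟎 · c + _) = <-coef (n<1+n c)
β<ₒsuccβ (ω^ (ω^ _ · _ + _) · _ + b) = <-rest (β<ₒsuccβ b)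

succ-nf : ∀ {β} → NF β → NF (succ β)
succ-nf nf-𝟎 = nf-ω nf-𝟎 nf-𝟎 tt
succ-nf {ω^ 𝟎 · _ + _} (nf-ω na nb eb) = nf-ω na nb eb
succ-nf {ω^ (ω^ _ · _ + _) · _ + b} (nf-ω na nb eb) = nf-ω na (succ-nf nb) (expBelow-succ b eb)

pr-succ : ∀ β → pr (succ β) ≡ just β
pr-succ 𝟎 = refl
pr-succ (ω^ 𝟎 · _ + _) = refl
pr-succ (ω^ (ω^ _ · _ + _) · _ + b) rewrite pr-succ b = refl

succ-injective : ∀ {β β'} → succ β ≡ succ β' → β ≡ β'
succ-injective {β} {β'} e = just-injective (trans (sym (pr-succ β)) (trans (cong pr e) (pr-succ β')))

pr-just : ∀ {α β} → NF α → pr α ≡ just β → α ≡ succ β × NF β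
pr-just {ω^ 𝟎 · zero + 𝟎} _ refl = refl , nf-𝟎
pr-just {ω^ 𝟎 · suc _ + 𝟎} _ refl = refl , nf-ω nf-𝟎 nf-𝟎 tt
pr-just {ω^ 𝟎 · _ + (ω^ _ · _ + _)} (nf-ω _ _ ()) _
pr-just {ω^ (ω^ _ · _ + _) · _ + b} (nf-ω na nb eb) eq with pr b in eqb | eq
... | nothing | ()
... | just β | refl with pr-just nb eqb
...   | refl , nβ = refl , nf-ω na nβ (expBelow-succ⁻ β eb)

pr-nothing : ∀ {α} → NF α → α ≢ 𝟎 → pr α ≡ nothing → Limit α
pr-nothing {𝟎} _ α≢𝟎 _ = ⊥-elim (α≢𝟎 refl)
pr-nothing {ω^ 𝟎 · zero + _} _ _ ()
pr-nothing {ω^ 𝟎 · suc _ + _} _ _ ()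
pr-nothing {ω^ (ω^ _ · _ + _) · _ + 𝟎} _ _ _ = lim-last (λ ())
pr-nothing {ω^ (ω^ _ · _ + _) · _ + b@(ω^ _ · _ + _)} (nf-ω _ nb _) _ eq with pr b in eqb | eq
... | nothing | _ = lim-cons (pr-nothing nb (λ ()) eqb)
... | just _ | ()

limit-pr : ∀ {λ'} → NF λ' → Limit λ' → pr λ' ≡ nothing
limit-pr {ω^ 𝟎 · _ + _} _ (lim-last a≢𝟎) = ⊥-elim (a≢𝟎 refl)
limit-pr {ω^ 𝟎 · _ + (ω^ _ · _ + _)} (nf-ω _ _ ()) (lim-cons _)
limit-pr {ω^ (ω^ _ · _ + _) · _ + 𝟎} _ _ = refl
limit-pr {ω^ (ω^ _ · _ + _) · _ + (ω^ _ · _ + _)} (nf-ω _ nb _) (lim-cons l) rewrite limit-pr nb l = refl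

succ≢𝟎 : ∀ β → succ β ≢ 𝟎
succ≢𝟎 β e = case trans (sym (pr-succ β)) (cong pr e) of λ ()

succ-not-limit : ∀ {β} → NF β → ¬ Limit (succ β)
succ-not-limit {β} nβ l = case trans (sym (pr-succ β)) (limit-pr (succ-nf nβ) l) of λ ()

successor-or-limit : ∀ {α} → NF α → α ≢ 𝟎 → (Σ Ord λ β → NF β × α ≡ succ β) ⊎ Limit α
successor-or-limit {α} nf α≢𝟎 with pr α in eq
... | just β = let (α≡β+1 , nβ) = pr-just nf eq in inj₁ (β , nβ , α≡β+1)
... | nothing = inj₂ (pr-nothing nf α≢𝟎 eq)

record Approximates (μ λ' : Ord) : Set where
  field
    normal : NF μ
    below : μ <ₒ λ'
    keepsExpBelow : ∀ e → ExpBelow λ' e → ExpBelow μ e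
open Approximates

tail-limit : ∀ {a c b} → Limit (ω^ a · c + b) → b ≢ 𝟎 → Limit b
tail-limit (lim-last _) b≢𝟎 = ⊥-elim (b≢𝟎 refl)
tail-limit (lim-cons l) _ = l

mutual
  fs-approximates : ∀ {λ'} x → NF λ' → Limit λ' → Approximates (fs λ' x) λ'
  fs-approximates {ω^ a · c + (ω^ _ · _ + _)} x (nf-ω na nb eb) l =
    let ih = fs-approximates x nb (tail-limit l (λ ())) in
    record { normal = nf-ω na (normal ih) (keepsExpBelow ih a eb)
           ; below = <-rest (below ih)
           ; keepsExpBelow = λ _ h → h }
  fs-approximates {ω^ a · zero + 𝟎} x (nf-ω na _ _) (lim-last a≢𝟎) =
    let (n , eb) = fsω-approximates x na a≢𝟎 in
    record { normal = n
           ; below = expBelow⇒<ₒ _ eb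
           ; keepsExpBelow = λ _ h → expBelow-trans _ eb h }
  fs-approximates {ω^ a · suc c + 𝟎} x (nf-ω na _ _) (lim-last a≢𝟎) =
    let (n , eb) = fsω-approximates x na a≢𝟎 in
    record { normal = nf-ω na n eb
           ; below = <-coef (n<1+n c)
           ; keepsExpBelow = λ _ h → h }

  fsω-approximates : ∀ {a} x → NF a → a ≢ 𝟎 → NF (fsω a (pr a) x) × ExpBelow (fsω a (pr a) x) a
  fsω-approximates {a} x na a≢𝟎 with pr a in eq
  ... | just a₀ = let (a≡a₀+1 , na₀) = pr-just na eq in
                  nf-ω na₀ nf-𝟎 tt , subst (a₀ <ₒ_) (sym a≡a₀+1) (β<ₒsuccβ a₀)
  ... | nothing = let ih = fs-approximates x na (pr-nothing na a≢𝟎 eq) in nf-ω (normal ih) nf-𝟎 tt , below ih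

data _⋖[_]_ : Ord → ℕ → Ord → Set where
  ⋖-succ : ∀ {x β} → NF β → β ⋖[ x ] succ β
  ⋖-lim  : ∀ {x λ'} → NF λ' → Limit λ' → fs λ' x ⋖[ x ] λ'

⋖-into-succ : ∀ {x δ α β} → NF β → α ≡ succ β → δ ⋖[ x ] α → δ ≡ β
⋖-into-succ _ α≡β+1 (⋖-succ _) = succ-injective α≡β+1
⋖-into-succ nβ α≡β+1 (⋖-lim _ l) = ⊥-elim (succ-not-limit nβ (subst Limit α≡β+1 l))

⋖-into-limit : ∀ {x δ λ'} → Limit λ' → δ ⋖[ x ] λ' → δ ≡ fs λ' x
⋖-into-limit l (⋖-succ nβ) = ⊥-elim (succ-not-limit nβ l)
⋖-into-limit _ (⋖-lim _ _) = refl

⋖-unique : ∀ {x δ δ' α} → δ ⋖[ x ] α → δ' ⋖[ x ] α → δ ≡ δ'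
⋖-unique (⋖-succ nβ) δ'⋖α = sym (⋖-into-succ nβ refl δ'⋖α)
⋖-unique (⋖-lim _ l) δ'⋖α = sym (⋖-into-limit l δ'⋖α)

_≼[_]_ : Ord → ℕ → Ord → Set
α ≼[ x ] β = (α ≡ β) ⊎ (α ≺[ x ] β)

≺-last-step : ∀ {x α' α} → α' ≺[ x ] α → Σ Ord λ δ → α' ≼[ x ] δ × δ ⋖[ x ] α
≺-last-step (≺-succ nβ) = _ , inj₁ refl , ⋖-succ nβ
≺-last-step (≺-lim nf l) = _ , inj₁ refl , ⋖-lim nf l
≺-last-step (≺-trans p q) with ≺-last-step q
... | δ , inj₁ refl , step = δ , inj₂ p , step
... | δ , inj₂ r , step = δ , inj₂ (≺-trans p r) , step

≺-below-step : ∀ {x α' δ α} → α' ≺[ x ] α → δ ⋖[ x ] α → α' ≼[ x ] δ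
≺-below-step α'≺α δ⋖α with ≺-last-step α'≺α
... | δ' , α'≼δ' , δ'⋖α rewrite ⋖-unique δ'⋖α δ⋖α = α'≼δ'

≺⇒<ₒ : ∀ {x α β} → α ≺[ x ] β → α <ₒ β
≺⇒<ₒ (≺-succ {β = β} _) = β<ₒsuccβ β
≺⇒<ₒ {x} (≺-lim nf l) = below (fs-approximates x nf l)
≺⇒<ₒ (≺-trans p q) = <ₒ-trans (≺⇒<ₒ p) (≺⇒<ₒ q)

≼⇒≤ₒ : ∀ {x α β} → α ≼[ x ] β → α ≤ₒ β
≼⇒≤ₒ (inj₁ α≡β) = inj₂ α≡β
≼⇒≤ₒ (inj₂ α≺β) = inj₁ (≺⇒<ₒ α≺β)

-- They
-- contain the nonzero k-lean ordinals and are closed under λ ↦ λ[k].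
data AlmostLean (k : ℕ) : Ord → Set where
  al-cons : ∀ {a c b} → coef c ≤ k → Lean k a → AlmostLean k b → AlmostLean k (ω^ a · c + b)
  al-last : ∀ {a c} → coef c ≤ suc k → Lean k a → AlmostLean k (ω^ a · c + 𝟎)
  al-ω    : ∀ {a} → AlmostLean k a → AlmostLean k (ω^ a · zero + 𝟎)

almostLean≢𝟎 : ∀ {k α} → AlmostLean k α → α ≢ 𝟎
almostLean≢𝟎 (al-cons _ _ _) ()
almostLean≢𝟎 (al-last _ _) ()
almostLean≢𝟎 (al-ω _) ()

lean⇒almostLean : ∀ {k α} → Lean k α → α ≢ 𝟎 → AlmostLean k α
lean⇒almostLean lean-𝟎 α≢𝟎 = ⊥-elim (α≢𝟎 refl)
lean⇒almostLean (lean-ω c≤k la lean-𝟎) _ = al-last (m≤n⇒m≤1+n c≤k) la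
lean⇒almostLean (lean-ω c≤k la lb@(lean-ω _ _ _)) _ = al-cons c≤k la (lean⇒almostLean lb (λ ()))

almostLean-cons⁻ : ∀ {k a c b} → AlmostLean k (ω^ a · c + b) → b ≢ 𝟎 →
  coef c ≤ k × Lean k a × AlmostLean k b
almostLean-cons⁻ (al-cons c≤k la alb) _ = c≤k , la , alb
almostLean-cons⁻ (al-last _ _) b≢𝟎 = ⊥-elim (b≢𝟎 refl)
almostLean-cons⁻ (al-ω _) b≢𝟎 = ⊥-elim (b≢𝟎 refl)

almostLean-succ⇒lean : ∀ {k β} → NF β → AlmostLean k (succ β) → Lean k β
almostLean-succ⇒lean nf-𝟎 _ = lean-𝟎
almostLean-succ⇒lean {β = ω^ 𝟎 · _ + 𝟎} _ (al-last c+1≤k+1 la) = lean-ω (≤-pred c+1≤k+1) la lean-𝟎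
almostLean-succ⇒lean {β = ω^ 𝟎 · _ + 𝟎} _ (al-cons _ _ ())
almostLean-succ⇒lean {β = ω^ 𝟎 · _ + (ω^ _ · _ + _)} (nf-ω _ _ ()) _
almostLean-succ⇒lean {β = ω^ (ω^ _ · _ + _) · _ + b} (nf-ω _ nb _) al =
  let (c≤k , la , alb) = almostLean-cons⁻ al (succ≢𝟎 b) in lean-ω c≤k la (almostLean-succ⇒lean nb alb)

LeavesLean : ℕ → Ord → Set
LeavesLean k μ = AlmostLean k μ × ¬ Lean k μ

mutual
  fs-leavesLean : ∀ {k λ'} → NF λ' → Limit λ' → AlmostLean k λ' → LeavesLean k (fs λ' k)
  fs-leavesLean {λ' = ω^ _ · _ + (ω^ _ · _ + _)} (nf-ω _ nb _) l al =
    let (c≤k , la , alb) = almostLean-cons⁻ al (λ ())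
        (alμ , notLean) = fs-leavesLean nb (tail-limit l (λ ())) alb
    in al-cons c≤k la alμ , λ { (lean-ω _ _ lμ) → notLean lμ }
  fs-leavesLean {λ' = ω^ _ · zero + 𝟎} (nf-ω na _ _) (lim-last a≢𝟎) (al-last _ la) =
    fsω-leavesLean na a≢𝟎 (lean⇒almostLean la a≢𝟎)
  fs-leavesLean {λ' = ω^ _ · zero + 𝟎} (nf-ω na _ _) (lim-last a≢𝟎) (al-ω ala) = fsω-leavesLean na a≢𝟎 ala
  fs-leavesLean {λ' = ω^ _ · suc _ + 𝟎} (nf-ω na _ _) (lim-last a≢𝟎) (al-last c+1≤k+1 la) =
    let (alμ , notLean) = fsω-leavesLean na a≢𝟎 (lean⇒almostLean la a≢𝟎)
    in al-cons (≤-pred c+1≤k+1) la alμ , λ { (lean-ω _ _ lμ) → notLean lμ }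
  fs-leavesLean {λ' = ω^ _ · _ + 𝟎} _ (lim-last _) (al-cons _ _ ())

  -- (ω^(a₀+1))[k] = ω^a₀·(k+1) has coefficient k + 1; (ω^λ)[k] = ω^(λ[k]).
  fsω-leavesLean : ∀ {k a} → NF a → a ≢ 𝟎 → AlmostLean k a → LeavesLean k (fsω a (pr a) k)
  fsω-leavesLean {a = a} na a≢𝟎 ala with pr a in eq
  ... | just a₀ = let (a≡a₀+1 , na₀) = pr-just na eq in
                  al-last ≤-refl (almostLean-succ⇒lean na₀ (subst (AlmostLean _) a≡a₀+1 ala)) ,
                  λ { (lean-ω k+1≤k _ _) → 1+n≰n k+1≤k }
  ... | nothing = let (alμ , notLean) = fs-leavesLean na (pr-nothing na a≢𝟎 eq) ala
                  in al-ω alμ , λ { (lean-ω _ lμ _) → notLean lμ }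

-- β ⊏ α: β is a normal form below α.  Every normal form is ⊏-accessible,
-- which is the induction principle for the main argument.
_⊏_ : Ord → Ord → Set
β ⊏ α = NF β × β <ₒ α

acc-𝟎 : Acc _⊏_ 𝟎
acc-𝟎 = acc λ ()

AccBelowExp : Ord → Set
AccBelowExp e = ∀ {γ} → NF γ → ExpBelow γ e → Acc _⊏_ γ

acc-term : ∀ {e c r} → AccBelowExp e → Acc _<ℕ_ c → NF r → ExpBelow r e → Acc _⊏_ (ω^ e · c + r)
acc-term {e} {c} accBelow (acc smallerCoef) nr er = withTail (accBelow nr er)
  where
  withTail : ∀ {r} → Acc _⊏_ r → Acc _⊏_ (ω^ e · c + r)
  withTail (acc smallerRest) = acc λ where
    (_ , <-zero) → acc-𝟎
    (nδ , <-exp δ<e) → accBelow nδ δ<e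
    (nf-ω _ nb eb , <-coef c'<c) → acc-term accBelow (smallerCoef c'<c) nb eb
    (nf-ω _ nb _ , <-rest b<r) → withTail (smallerRest (nb , b<r))

accBelowExp : ∀ {e} → Acc _⊏_ e → AccBelowExp e
accBelowExp _ nf-𝟎 _ = acc-𝟎
accBelowExp (acc smaller) (nf-ω na nr er) a<e =
  acc-term (accBelowExp (smaller (na , a<e))) (<-wellFounded _) nr er

nf-accessible : ∀ {α} → NF α → Acc _⊏_ α
nf-accessible nf-𝟎 = acc-𝟎
nf-accessible (nf-ω na nr er) = acc-term (accBelowExp (nf-accessible na)) (<-wellFounded _) nr er

LeanPredecessor : ℕ → Ord → Ord → Set
LeanPredecessor k α β = P k α β × NF β × Lean k β × β ≺[ k ] α ×
  ((α' : Ord) → NF α' → Lean k α' → α' ≺[ k ] α → α' ≤ₒ β)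

-- For β + 1 the only candidates α' ≺ β + 1 are those ≼ β.
successor-case : ∀ {k β} → NF β → Lean k β → LeanPredecessor k (succ β) β
successor-case nβ lβ =
  P-succ nβ , nβ , lβ , ≺-succ nβ , λ _ _ _ α'≺ → ≼⇒≤ₒ (≺-below-step α'≺ (⋖-succ nβ))

-- A lean predecessor of a non-lean λ[k] is one of λ: the only new candidate
-- α' ≺ λ not already ≺ λ[k] is λ[k] itself, which is not lean.
limit-case : ∀ {k λ' β} → NF λ' → Limit λ' → ¬ Lean k (fs λ' k) →
  LeanPredecessor k (fs λ' k) β → LeanPredecessor k λ' β
limit-case {k} {λ'} {β} nf l notLean (Pβ , nβ , lβ , β≺ , bound) =
  P-lim nf l Pβ , nβ , lβ , ≺-trans β≺ (≺-lim nf l) , bound'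
  where
  bound' : (α' : Ord) → NF α' → Lean k α' → α' ≺[ k ] λ' → α' ≤ₒ β
  bound' α' nα' lα' α'≺ with ≺-below-step α'≺ (⋖-lim nf l)
  ... | inj₁ refl = ⊥-elim (notLean lα')
  ... | inj₂ α'≺fs = bound α' nα' lα' α'≺fs

lean-predecessor : ∀ k {α} → Acc _⊏_ α → NF α → AlmostLean k α → Σ Ord (LeanPredecessor k α)
lean-predecessor k (acc smaller) nf al with successor-or-limit nf (almostLean≢𝟎 al)
... | inj₁ (β , nβ , refl) = β , successor-case nβ (almostLean-succ⇒lean nβ al)
... | inj₂ l =
  let approx = fs-approximates k nf l
      (alμ , notLean) = fs-leavesLean nf l al
      (β , isPred) = lean-predecessor k (smaller (normal approx , below approx)) (normal approx) alμ
  in β , limit-case nf l notLean isPred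

lemma17 : (k : ℕ) (α : Ord) → NF α → ¬ (α ≡ 𝟎) → Lean k α →
    Σ Ord (λ β → P k α β × NF β × Lean k β × β ≺[ k ] α ×
      ((α' : Ord) → NF α' → Lean k α' → α' ≺[ k ] α → α' ≤ₒ β))
lemma17 k α nf α≢𝟎 l = lean-predecessor k (nf-accessible nf) nf (lean⇒almostLean l α≢𝟎)
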